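{- Let $\mathsf{P} : \mathsf{E} \rightarrow \mathsf{B}$ be an order-enriched fibration. Let $f, g : B \rightarrow A$ be a parallel pair of $\mathsf{E}$-morphisms and let $e : E \rightarrow B$ be an equalizer of $f$ and $g$ in $\mathsf{E}$. Then $e$ is a cartesian $\mathsf{E}$-morphism (for the fiber pair $(\mathsf{P}(e), B)$).
   Context: All composition is written in diagrammatic order: $f \cdot g$ means first $f$, then $g$. An order-enriched category is a category whose hom-sets $\mathsf{C}(A,B)$ are preorders such that composition is monotone in each argument; write $f \equiv g$ when $f \leq g$ and $g \leq f$. An order-enriched functor is a functor whose action on each hom-preorder is monotone. For a functor $\mathsf{P} : \mathsf{E} \rightarrow \mathsf{B}$: a fiber pair $(b, E_1)$ consists of a $\mathsf{B}$-morphism $b : B_2 \rightarrow B_1$ and an $\mathsf{E}$-object $E_1$ with $\mathsf{P}(E_1) = B_1$. An $\mathsf{E}$-morphism $e : E_2 \rightarrow E_1$ is cartesian for $(b,E_1)$ if $\mathsf{P}(e) = b$ and for every $\mathsf{E}$-morphism $v : E \rightarrow E_1$ and every $\mathsf{B}$-morphism $x : \mathsf{P}(E) \rightarrow B_2$ with $x \cdot b = \mathsf{P}(v)$ there is a unique $\mathsf{E}$-morphism $u : E \rightarrow E_2$ with $u \cdot e = v$ and $\mathsf{P}(u) = x$. $\mathsf{P}$ is a fibration if every fiber pair has a cartesian morphism; a cleavage is a choice $\gamma(b,E_1)$ of such a cartesian morphism for each fiber pair; it is a splitting if $\gamma(1_B,E) = 1_E$ and $\gamma(b_2 \cdot b_1,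 E_1) = \gamma(b_2, E_2) \cdot \gamma(b_1,E_1)$ where $E_2$ is the source of $\gamma(b_1,E_1)$; a split fibration is one with a splitting. For an $\mathsf{E}$-morphism $e : E_2 \rightarrow E_1$, its lift is $\sharp_e = \gamma(\mathsf{P}(e), E_1) : \Delta(e) \rightarrow E_1$, its apex is the source $\Delta(e)$, and its gap is the unique $\flat_e : E_2 \rightarrow \Delta(e)$ with $\mathsf{P}(\flat_e) = 1_{\mathsf{P}(E_2)}$ and $e = \flat_e \cdot \sharp_e$. An order-enriched fibration is an order-enriched functor $\mathsf{P} : \mathsf{E} \rightarrow \mathsf{B}$ between order-enriched categories which is a split fibration (with chosen splitting $\gamma$) such that: (i) $\mathsf{P}$ is faithful, replete, and preserves limits; (ii) (cleavage uniqueness) if $e : E_2 \rightarrow E_1$ is cartesian then $\Delta(e) = E_2$, $\flat_e = 1_{E_2}$, $\sharp_e = e$; (iii) (right cancellation) for every cartesian $e : E_2 \rightarrow E_1$ and parallel $g,h : E_3 \rightarrow E_2$, $g \cdot e \leq h \cdot e$ implies $g \leq h$; (iv) (left cancellation) for every $\mathsf{E}$-morphism $e$ and parallel $g,h : \Delta(e) \rightarrow E$, $\flat_e \cdot g \leq \flat_e \cdot h$ implies $g \leq h$; (v) (equivalence factorization) if $f \equiv g : E_2 \rightarrow E_1$ then $\Delta(f) = \Delta(g)$, $\flat_f = \flat_g$ and $\sharp_f \equiv \sharp_g$. -}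

module Defs where

open import Level using (Level; _⊔_; 0ℓ) renaming (suc to lsuc)
open import Data.Product using (Σ; _×_; _,_; proj₁; proj₂)
open import Relation.Binary.PropositionalEquality
  using (_≡_; refl; sym; subst; subst₂)

-- Ordinary (small-ish) categories, used as index categories of limits.
-- Composition is diagrammatic: f · g = first f, then g.

record Category (o h : Level) : Set (lsuc (o ⊔ h)) where
  infixl 9 _·_
  field
    Obj  : Set o
    Hom  : Obj → Obj → Set h
    id   : ∀ {A} → Hom A A
    _·_  : ∀ {A B C} → Hom A B → Hom B C → Hom A C
    idˡ  : ∀ {A B} (f : Hom A B) → id · f ≡ f
    idʳ  : ∀ {A B} (f : Hom A B) → f · id ≡ f
    assoc : ∀ {A B C D} (f : Hom A B) (g : Hom B C) (k : Hom C D) →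
            (f · g) · k ≡ f · (g · k)

record OrdCat (o h r : Level) : Set (lsuc (o ⊔ h ⊔ r)) where
  infixl 9 _·_
  infix 4 _≤_
  field
    Obj  : Set o
    Hom  : Obj → Obj → Set h
    id   : ∀ {A} → Hom A A
    _·_  : ∀ {A B C} → Hom A B → Hom B C → Hom A C
    idˡ  : ∀ {A B} (f : Hom A B) → id · f ≡ f
    idʳ  : ∀ {A B} (f : Hom A B) → f · id ≡ f
    assoc : ∀ {A B C D} (f : Hom A B) (g : Hom B C) (k : Hom C D) →
            (f · g) · k ≡ f · (g · k)
    _≤_   : ∀ {A B} → Hom A B → Hom A B → Set r
    ≤-refl  : ∀ {A B} {f : Hom A B} → f ≤ f
    ≤-trans : ∀ {A B} {f g k : Hom A B} → f ≤ g → g ≤ k → f ≤ k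
    ·-mono  : ∀ {A B C} {f f' : Hom A B} {g g' : Hom B C} →
              f ≤ f' → g ≤ g' → f · g ≤ f' · g'

  -- f ≡ g in the paper's notation (f ≤ g and g ≤ f)
  _≈_ : ∀ {A B} → Hom A B → Hom A B → Set r
  f ≈ g = (f ≤ g) × (g ≤ f)

  HomEq : ∀ {A B A' B'} → Hom A B → Hom A' B' → Set (o ⊔ h)
  HomEq {A} {B} {A'} {B'} f g =
    Σ (A ≡ A') λ p → Σ (B ≡ B') λ q → subst₂ Hom p q f ≡ g

  IsIso : ∀ {A B} → Hom A B → Set h
  IsIso {A} {B} f = Σ (Hom B A) λ g → (f · g ≡ id) × (g · f ≡ id)

  IsEqualizer : ∀ {X B A} (f g : Hom B A) (e : Hom X B) → Set (o ⊔ h)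
  IsEqualizer {X} {B} {A} f g e =
    (e · f ≡ e · g) ×
    (∀ {Y} (v : Hom Y B) → v · f ≡ v · g →
       Σ (Hom Y X) λ u → (u · e ≡ v) × (∀ (u' : Hom Y X) → u' · e ≡ v → u' ≡ u))

  record Diagram (J : Category 0ℓ 0ℓ) : Set (o ⊔ h) where
    module J = Category J
    field
      D₀ : J.Obj → Obj
      D₁ : ∀ {i j} → J.Hom i j → Hom (D₀ i) (D₀ j)
      D-id : ∀ {i} → D₁ (J.id {i}) ≡ id
      D-∘  : ∀ {i j k} (a : J.Hom i j) (b : J.Hom j k) →
             D₁ (a J.· b) ≡ D₁ a · D₁ b

  record Cone {J : Category 0ℓ 0ℓ} (D : Diagram J) : Set (o ⊔ h) where
    private module I = Category J
    open Diagram D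
    field
      apex : Obj
      leg  : ∀ j → Hom apex (D₀ j)
      commute : ∀ {i j} (a : I.Hom i j) → leg i · D₁ a ≡ leg j

  IsLimit : ∀ {J : Category 0ℓ 0ℓ} {D : Diagram J} → Cone D → Set (o ⊔ h)
  IsLimit {J} {D} c =
    ∀ (c' : Cone D) →
      Σ (Hom (Cone.apex c') (Cone.apex c)) λ u →
        (∀ j → u · Cone.leg c j ≡ Cone.leg c' j) ×
        (∀ (u' : Hom (Cone.apex c') (Cone.apex c)) →
           (∀ j → u' · Cone.leg c j ≡ Cone.leg c' j) → u' ≡ u)

record OrdFunctor {oe he re ob hb rb}
       (E : OrdCat oe he re) (B : OrdCat ob hb rb)
       : Set (oe ⊔ he ⊔ re ⊔ ob ⊔ hb ⊔ rb) where
  private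
    module E = OrdCat E
    module B = OrdCat B
  field
    F₀ : E.Obj → B.Obj
    F₁ : ∀ {X Y} → E.Hom X Y → B.Hom (F₀ X) (F₀ Y)
    F-id : ∀ {X} → F₁ (E.id {X}) ≡ B.id
    F-∘  : ∀ {X Y Z} (f : E.Hom X Y) (g : E.Hom Y Z) →
           F₁ (f E.· g) ≡ F₁ f B.· F₁ g
    F-mono : ∀ {X Y} {f g : E.Hom X Y} → f E.≤ g → F₁ f B.≤ F₁ g

  mapDiagram : ∀ {J} → E.Diagram J → B.Diagram J
  mapDiagram D = record
    { D₀ = λ j → F₀ (D₀ j)
    ; D₁ = λ a → F₁ (D₁ a)
    ; D-id = Relation.Binary.PropositionalEquality.trans
               (Relation.Binary.PropositionalEquality.cong F₁ D-id) F-id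
    ; D-∘ = λ a b → Relation.Binary.PropositionalEquality.trans
               (Relation.Binary.PropositionalEquality.cong F₁ (D-∘ a b))
               (F-∘ (D₁ a) (D₁ b))
    }
    where open E.Diagram D

  mapCone : ∀ {J} {D : E.Diagram J} → E.Cone D → B.Cone (mapDiagram D)
  mapCone {J} {D} c = record
    { apex = F₀ apex
    ; leg = λ j → F₁ (leg j)
    ; commute = λ a → Relation.Binary.PropositionalEquality.trans
                  (sym (F-∘ (leg _) (E.Diagram.D₁ D a)))
                  (Relation.Binary.PropositionalEquality.cong F₁ (commute a))
    }
    where open E.Cone c

  Faithful : Set (oe ⊔ he ⊔ hb)
  Faithful = ∀ {X Y} (f g : E.Hom X Y) → F₁ f ≡ F₁ g → f ≡ g

  Replete : Set (oe ⊔ he ⊔ ob ⊔ hb)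
  Replete = ∀ {X} (E₀ : E.Obj) (b : B.Hom X (F₀ E₀)) → B.IsIso b →
            Σ E.Obj λ E' → Σ (E.Hom E' E₀) λ e → E.IsIso e × B.HomEq (F₁ e) b

  PreservesLimits : Set (lsuc 0ℓ ⊔ oe ⊔ he ⊔ ob ⊔ hb)
  PreservesLimits = ∀ (J : Category 0ℓ 0ℓ) (D : E.Diagram J) (c : E.Cone D) →
                    E.IsLimit c → B.IsLimit (mapCone c)

-- Cartesian morphisms: e : E₂ → E₁ is cartesian for the fiber pair (P e, E₁)

module _ {oe he re ob hb rb} {E : OrdCat oe he re} {B : OrdCat ob hb rb}
         (P : OrdFunctor E B) where
  private
    module E = OrdCat E
    module B = OrdCat B
  open OrdFunctor P

  IsCartesian : ∀ {E₂ E₁} → E.Hom E₂ E₁ → Set (oe ⊔ he ⊔ hb)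
  IsCartesian {E₂} {E₁} e =
    ∀ {E₀} (v : E.Hom E₀ E₁) (x : B.Hom (F₀ E₀) (F₀ E₂)) → x B.· F₁ e ≡ F₁ v →
      Σ (E.Hom E₀ E₂) λ u → ((u E.· e ≡ v) × (F₁ u ≡ x)) ×
        (∀ (u' : E.Hom E₀ E₂) → (u' E.· e ≡ v) × (F₁ u' ≡ x) → u' ≡ u)

-- Split fibrations (with a chosen splitting γ).
-- A fiber pair (b, E₁) is given as E₁ together with b : B₂ → F₀ E₁.

record SplitFibration {oe he re ob hb rb}
       (E : OrdCat oe he re) (B : OrdCat ob hb rb)
       : Set (oe ⊔ he ⊔ re ⊔ ob ⊔ hb ⊔ rb) where
  private
    module E = OrdCat E
    module B = OrdCat B
  field
    P : OrdFunctor E B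
  open OrdFunctor P
  field
    apex      : ∀ {B₂} (E₁ : E.Obj) (b : B.Hom B₂ (F₀ E₁)) → E.Obj
    apex-over : ∀ {B₂} (E₁ : E.Obj) (b : B.Hom B₂ (F₀ E₁)) → F₀ (apex E₁ b) ≡ B₂
    γ         : ∀ {B₂} (E₁ : E.Obj) (b : B.Hom B₂ (F₀ E₁)) → E.Hom (apex E₁ b) E₁
    γ-over    : ∀ {B₂} (E₁ : E.Obj) (b : B.Hom B₂ (F₀ E₁)) → B.HomEq (F₁ (γ E₁ b)) b
    γ-cart    : ∀ {B₂} (E₁ : E.Obj) (b : B.Hom B₂ (F₀ E₁)) → IsCartesian P (γ E₁ b)
    split-id   : ∀ (E₀ : E.Obj) → E.HomEq (γ E₀ (B.id {F₀ E₀})) (E.id {E₀})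
    split-comp : ∀ {B₃ B₂} (E₁ : E.Obj) (b₁ : B.Hom B₂ (F₀ E₁)) (b₂ : B.Hom B₃ B₂) →
                 E.HomEq (γ E₁ (b₂ B.· b₁))
                   (γ (apex E₁ b₁)
                      (subst (B.Hom B₃) (sym (apex-over E₁ b₁)) b₂)
                    E.· γ E₁ b₁)

  Δ : ∀ {E₂ E₁} → E.Hom E₂ E₁ → E.Obj
  Δ {E₂} {E₁} e = apex E₁ (F₁ e)

  ♯ : ∀ {E₂ E₁} (e : E.Hom E₂ E₁) → E.Hom (Δ e) E₁
  ♯ {E₂} {E₁} e = γ E₁ (F₁ e)

  -- k is the gap ♭e (which exists uniquely by cartesianness of ♯e)
  IsGap : ∀ {E₂ E₁} (e : E.Hom E₂ E₁) → E.Hom E₂ (Δ e) → Set (he ⊔ ob ⊔ hb)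
  IsGap {E₂} {E₁} e k = B.HomEq (F₁ k) (B.id {F₀ E₂}) × (k E.· ♯ e ≡ e)

record OrderEnrichedFibration {oe he re ob hb rb}
       (E : OrdCat oe he re) (B : OrdCat ob hb rb)
       : Set (lsuc 0ℓ ⊔ oe ⊔ he ⊔ re ⊔ ob ⊔ hb ⊔ rb) where
  private
    module E = OrdCat E
    module B = OrdCat B
  field
    split : SplitFibration E B
  open SplitFibration split
  open OrdFunctor P
  field
    faithful : Faithful
    replete  : Replete
    preserves-limits : PreservesLimits
    cleavage-unique : ∀ {E₂ E₁} (e : E.Hom E₂ E₁) → IsCartesian P e →
      Σ (Δ e ≡ E₂) λ p →
        (subst (λ X → E.Hom X E₁) p (♯ e) ≡ e) ×
        (∀ (k : E.Hom E₂ (Δ e)) → IsGap e k → subst (E.Hom E₂) p k ≡ E.id)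
    right-cancel : ∀ {E₃ E₂ E₁} (e : E.Hom E₂ E₁) → IsCartesian P e →
      (g h : E.Hom E₃ E₂) → g E.· e E.≤ h E.· e → g E.≤ h
    left-cancel : ∀ {E₂ E₁ E₀} (e : E.Hom E₂ E₁) (k : E.Hom E₂ (Δ e)) → IsGap e k →
      (g h : E.Hom (Δ e) E₀) → k E.· g E.≤ k E.· h → g E.≤ h
    equiv-fact : ∀ {E₂ E₁} (f g : E.Hom E₂ E₁) → f E.≈ g →
      Σ (Δ f ≡ Δ g) λ p →
        (∀ (kf : E.Hom E₂ (Δ f)) (kg : E.Hom E₂ (Δ g)) → IsGap f kf → IsGap g kg →
           subst (E.Hom E₂) p kf ≡ kg) ×
        (subst (λ X → E.Hom X E₁) p (♯ f) E.≈ ♯ g)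

  Fun : OrdFunctor E B
  Fun = P

module Submission where

-- Let s : D → B be the chosen cartesian lift of P e. Since P is faithful and P s is P e up to an
-- isomorphism ι of the base, s also equalizes f and g, so s = t · e for some t; cartesianness of s
-- gives k over ι with k · s = e, and k · t = 1 because e is mono, whence ι · P t = 1. A factorization
-- of v through e over x is then w · t, where w factors v through s over x · ι; uniqueness is again
-- monicity of e.

open import Defs
open import Data.Product using (Σ; _×_; _,_; proj₁; proj₂)
open import Relation.Binary.PropositionalEquality

module _ {o h r} (C : OrdCat o h r) where
  open OrdCat C

  HomEq⇒iso-· : ∀ {Y Z W} {a : Hom Y W} {b : Hom Z W} → HomEq a b →
                Σ (Hom Z Y) λ ι → IsIso ι × (ι · a ≡ b)
  HomEq⇒iso-· {a = a} (refl , refl , refl) = id , (id , idˡ id , idˡ id) , idˡ a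

  iso-cancelˡ : ∀ {Z Y W} {ι : Hom Z Y} {a b : Hom Y W} → IsIso ι → ι · a ≡ ι · b → a ≡ b
  iso-cancelˡ {ι = ι} {a} {b} (ι⁻¹ , _ , ι⁻¹ι≡id) ιa≡ιb = begin
    a                ≡⟨ sym (idˡ a) ⟩
    id · a           ≡⟨ cong (_· a) (sym ι⁻¹ι≡id) ⟩
    (ι⁻¹ · ι) · a    ≡⟨ assoc ι⁻¹ ι a ⟩
    ι⁻¹ · (ι · a)    ≡⟨ cong (ι⁻¹ ·_) ιa≡ιb ⟩
    ι⁻¹ · (ι · b)    ≡⟨ sym (assoc ι⁻¹ ι b) ⟩
    (ι⁻¹ · ι) · b    ≡⟨ cong (_· b) ι⁻¹ι≡id ⟩
    id · b           ≡⟨ idˡ b ⟩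
    b                ∎
    where open ≡-Reasoning

  equalizer-mono : ∀ {X B A Y} {f g : Hom B A} {e : Hom X B} → IsEqualizer f g e →
                   (u u' : Hom Y X) → u · e ≡ u' · e → u ≡ u'
  equalizer-mono {X} {Y = Y} {f} {g} {e} (ef≡eg , universal) u u' ue≡u'e =
    trans (unique u refl) (sym (unique u' (sym ue≡u'e)))
    where
      ue-equalizes : (u · e) · f ≡ (u · e) · g
      ue-equalizes = trans (assoc u e f) (trans (cong (u ·_) ef≡eg) (sym (assoc u e g)))
      unique : ∀ (u'' : Hom Y X) → u'' · e ≡ u · e → u'' ≡ proj₁ (universal (u · e) ue-equalizes)
      unique = proj₂ (proj₂ (universal (u · e) ue-equalizes))

module _ {oe he re ob hb rb} {E : OrdCat oe he re} {B : OrdCat ob hb rb}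
         (P : OrdFunctor E B) where
  private
    module E = OrdCat E
    module B = OrdCat B
  open OrdFunctor P

  equalizer-isCartesian :
    Faithful → ∀ {X D Bo A} {f g : E.Hom Bo A} {e : E.Hom X Bo} → E.IsEqualizer f g e →
    (s : E.Hom D Bo) → IsCartesian P s →
    Σ (B.Hom (F₀ X) (F₀ D)) (λ ι → B.IsIso ι × (ι B.· F₁ s ≡ F₁ e)) →
    IsCartesian P e
  equalizer-isCartesian faithful {X} {D} {f = f} {g} {e}
      equalizer@(ef≡eg , universal) s s-cartesian (ι , ι-iso , ιs≡e) {E₀} v x xe≡v =
    w E.· t , (twe≡v , P[wt]≡x) , λ u' (u'e≡v , _) → E-mono u' (w E.· t) (trans u'e≡v (sym twe≡v))
    where
      open ≡-Reasoning
      E-mono : ∀ {Y} (u u' : E.Hom Y X) → u E.· e ≡ u' E.· e → u ≡ u'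
      E-mono = equalizer-mono E equalizer

      s-equalizes : s E.· f ≡ s E.· g
      s-equalizes = faithful (s E.· f) (s E.· g) (iso-cancelˡ B ι-iso (begin
        ι B.· F₁ (s E.· f)       ≡⟨ cong (ι B.·_) (F-∘ s f) ⟩
        ι B.· (F₁ s B.· F₁ f)    ≡⟨ sym (B.assoc ι (F₁ s) (F₁ f)) ⟩
        (ι B.· F₁ s) B.· F₁ f    ≡⟨ cong (B._· F₁ f) ιs≡e ⟩
        F₁ e B.· F₁ f            ≡⟨ sym (F-∘ e f) ⟩
        F₁ (e E.· f)             ≡⟨ cong F₁ ef≡eg ⟩
        F₁ (e E.· g)             ≡⟨ F-∘ e g ⟩
        F₁ e B.· F₁ g            ≡⟨ cong (B._· F₁ g) (sym ιs≡e) ⟩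
        (ι B.· F₁ s) B.· F₁ g    ≡⟨ B.assoc ι (F₁ s) (F₁ g) ⟩
        ι B.· (F₁ s B.· F₁ g)    ≡⟨ cong (ι B.·_) (sym (F-∘ s g)) ⟩
        ι B.· F₁ (s E.· g)       ∎))

      t : E.Hom D X
      t = proj₁ (universal s s-equalizes)

      te≡s : t E.· e ≡ s
      te≡s = proj₁ (proj₂ (universal s s-equalizes))

      k : E.Hom X D
      k = proj₁ (s-cartesian e ι ιs≡e)

      ks≡e : k E.· s ≡ e
      ks≡e = proj₁ (proj₁ (proj₂ (s-cartesian e ι ιs≡e)))

      Pk≡ι : F₁ k ≡ ι
      Pk≡ι = proj₂ (proj₁ (proj₂ (s-cartesian e ι ιs≡e)))

      kt≡id : k E.· t ≡ E.id
      kt≡id = E-mono (k E.· t) E.id (begin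
        (k E.· t) E.· e   ≡⟨ E.assoc k t e ⟩
        k E.· (t E.· e)   ≡⟨ cong (k E.·_) te≡s ⟩
        k E.· s           ≡⟨ ks≡e ⟩
        e                 ≡⟨ sym (E.idˡ e) ⟩
        E.id E.· e        ∎)

      ιPt≡id : ι B.· F₁ t ≡ B.id
      ιPt≡id = begin
        ι B.· F₁ t        ≡⟨ cong (B._· F₁ t) (sym Pk≡ι) ⟩
        F₁ k B.· F₁ t     ≡⟨ sym (F-∘ k t) ⟩
        F₁ (k E.· t)      ≡⟨ cong F₁ kt≡id ⟩
        F₁ E.id           ≡⟨ F-id ⟩
        B.id              ∎

      xιs≡v : (x B.· ι) B.· F₁ s ≡ F₁ v
      xιs≡v = trans (B.assoc x ι (F₁ s)) (trans (cong (x B.·_) ιs≡e) xe≡v)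

      w : E.Hom E₀ D
      w = proj₁ (s-cartesian v (x B.· ι) xιs≡v)

      ws≡v : w E.· s ≡ v
      ws≡v = proj₁ (proj₁ (proj₂ (s-cartesian v (x B.· ι) xιs≡v)))

      Pw≡xι : F₁ w ≡ x B.· ι
      Pw≡xι = proj₂ (proj₁ (proj₂ (s-cartesian v (x B.· ι) xιs≡v)))

      twe≡v : (w E.· t) E.· e ≡ v
      twe≡v = trans (E.assoc w t e) (trans (cong (w E.·_) te≡s) ws≡v)

      P[wt]≡x : F₁ (w E.· t) ≡ x
      P[wt]≡x = begin
        F₁ (w E.· t)           ≡⟨ F-∘ w t ⟩
        F₁ w B.· F₁ t          ≡⟨ cong (B._· F₁ t) Pw≡xι ⟩
        (x B.· ι) B.· F₁ t     ≡⟨ B.assoc x ι (F₁ t) ⟩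
        x B.· (ι B.· F₁ t)     ≡⟨ cong (x B.·_) ιPt≡id ⟩
        x B.· B.id             ≡⟨ B.idʳ x ⟩
        x                      ∎

mainTheorem1 : ∀ {oe he re ob hb rb} {E : OrdCat oe he re} {B : OrdCat ob hb rb}
    (F : OrderEnrichedFibration E B)
    {X Bo A : OrdCat.Obj E} (f g : OrdCat.Hom E Bo A) (e : OrdCat.Hom E X Bo) →
    OrdCat.IsEqualizer E f g e →
    IsCartesian (OrderEnrichedFibration.Fun F) e
mainTheorem1 {B = B} F {Bo = Bo} _ _ e equalizer =
  equalizer-isCartesian P faithful equalizer
    (γ Bo (F₁ e)) (γ-cart Bo (F₁ e)) (HomEq⇒iso-· B (γ-over Bo (F₁ e)))
  where
    open OrderEnrichedFibration F
    open SplitFibration split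
    open OrdFunctor P
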